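{- Let $G$ be a nontrivial cyclic group of order $n$, let $S$ be the set of all generators of $G$, and let $\Gamma(G)$ be the generator graph of $G$. Then the Gutman index of $\Gamma(G)$ is $$Gut(\Gamma(G)) = \tfrac{1}{2}|S|(|S|-1)(n-1)^2 + |S|^2(n-|S|)(2n-|S|-2).$$
   Context: For a group $G$, the generator graph $\Gamma(G)$ is the simple undirected graph whose vertex set is the set of elements of $G$, in which two distinct elements $x,y$ are adjacent if and only if at least one of them generates $G$ (i.e. $\langle x\rangle = G$ or $\langle y\rangle = G$). For a connected graph $\Gamma$, the Gutman index is $Gut(\Gamma) = \sum_{\{u,v\}\subseteq V(\Gamma)} \deg_\Gamma(u)\deg_\Gamma(v)\, d_\Gamma(u,v)$, summing over unordered pairs of distinct vertices, where $d_\Gamma$ is the graph distance. -}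

module Defs where

open import Level using (0ℓ)
open import Algebra.Bundles using (Group)
open import Data.Nat using (ℕ; zero; suc; _+_; _*_; _∸_; _<_)
open import Data.Integer using (ℤ; +_; -[1+_])
open import Data.Fin using (Fin; toℕ)
open import Data.Bool using (Bool; true; false; _∧_; _∨_; not; if_then_else_)
open import Data.Product using (Σ; ∃; _×_; _,_)
open import Data.Nat.ListAction using (sum)
open import Data.List using (List; []; _∷_; map; allFin; filter; length; concatMap)
open import Relation.Nullary using (Dec; yes; no; ¬_; does)
open import Relation.Binary.PropositionalEquality using (_≡_)

module GroupDefs (G : Group 0ℓ 0ℓ) where
  open Group G

  _^_ : Carrier → ℕ → Carrier
  x ^ zero = ε
  x ^ suc k = x ∙ (x ^ k)

  _^ℤ_ : Carrier → ℤ → Carrier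
  x ^ℤ (+ k) = x ^ k
  x ^ℤ -[1+ k ] = (x ^ suc k) ⁻¹

  IsGenerator : Carrier → Set
  IsGenerator x = ∀ y → ∃ λ (k : ℤ) → y ≈ (x ^ℤ k)

  IsCyclic : Set
  IsCyclic = ∃ λ g → IsGenerator g

  record HasOrder (n : ℕ) : Set where
    field
      enum      : Fin n → Carrier
      injective : ∀ i j → enum i ≈ enum j → i ≡ j
      surjective : ∀ x → ∃ λ i → enum i ≈ x

-- The decision
-- procedures are arguments; since Dec determines its boolean uniquely,
-- the values below do not depend on which decision procedures are given.
module GeneratorGraph (G : Group 0ℓ 0ℓ) (n : ℕ) (ord : GroupDefs.HasOrder G n)
  (_≈?_ : ∀ x y → Dec (Group._≈_ G x y))
  (gen? : ∀ x → Dec (GroupDefs.IsGenerator G x)) where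
  open Group G
  open GroupDefs G
  open HasOrder ord

  V : Set
  V = Fin n

  vs : List V
  vs = allFin n

  isGen : V → Bool
  isGen i = does (gen? (enum i))

  same : V → V → Bool
  same i j = does (enum i ≈? enum j)

  adj : V → V → Bool
  adj i j = not (same i j) ∧ (isGen i ∨ isGen j)

  anyL : List V → (V → Bool) → Bool
  anyL [] p = false
  anyL (x ∷ xs) p = p x ∨ anyL xs p

  countL : List V → (V → Bool) → ℕ
  countL xs p = length (filter (λ x → Data.Bool.T? (p x)) xs)
    where import Data.Bool

  walk : ℕ → V → V → Bool
  walk zero i j = same i j
  walk (suc k) i j = anyL vs (λ l → adj i l ∧ walk k l j)

  -- least k ≤ bound with a walk of length k (= graph distance, since a
  -- shortest walk is a path); fallback bound+1 never used for connected graphs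
  distFrom : ℕ → ℕ → V → V → ℕ
  distFrom k zero i j = if walk k i j then k else suc k
  distFrom k (suc b) i j = if walk k i j then k else distFrom (suc k) b i j

  dist : V → V → ℕ
  dist i j = distFrom 0 n i j

  deg : V → ℕ
  deg i = countL vs (adj i)

  numGen : ℕ
  numGen = countL vs isGen

  -- unordered pairs of distinct vertices: i < j in the enumeration
  pairs : List (V × V)
  pairs = concatMap (λ i → concatMap (λ j →
            if Data.Nat._<ᵇ_ (toℕ i) (toℕ j) then (i , j) ∷ [] else []) vs) vs
    where import Data.Nat

  gutman : ℕ
  gutman = sum (map (λ { (i , j) → deg i * deg j * dist i j }) pairs)

-- Γ(G) is a complete split graph: the s generators are adjacent to every other vertex,
-- and a non-generator is adjacent only to the generators.  Hence a generator
-- has degree n − 1, a non-generator degree s, and distinct vertices are at distance 1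
-- unless both are non-generators, in which case they are at distance 2 through any
-- generator.  So the summand of the Gutman index depends only on the two classes and is
-- symmetric; twice the sum over unordered pairs plus the diagonal is the full double sum,
-- which factors through the class sizes s and n − s, and the formula is arithmetic.
{-# OPTIONS --safe #-}
module Submission where

open import Defs
open import Level using (0ℓ)
open import Algebra.Bundles using (Group)
open import Data.Nat using (ℕ; _+_; _*_; _∸_; _≤_; _^_)
open import Relation.Nullary using (Dec)
open import Relation.Binary.PropositionalEquality using (_≡_)

open import Data.Nat using (zero; suc; _<_; _<ᵇ_; z≤n; s≤s)
open import Data.Nat.Properties
  using (+-0-commutativeMonoid; +-assoc; +-comm; +-suc; +-identityʳ; *-comm; +-cancelʳ-≡;
         m+n∸m≡n; +-∸-assoc; <⇒≤; <⇒≱; m≤n⇒m<n∨m≡n; <ᵇ⇒<)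
open import Data.Nat.Tactic.RingSolver using (solve-∀)
open import Data.Nat.ListAction using (sum)
open import Data.Nat.ListAction.Properties using (sum-++)
open import Data.Bool using (Bool; true; false; not; _∧_; _∨_; if_then_else_; T; T?)
open import Data.Bool.Properties using (∨-zeroʳ; ∧-zeroʳ; ¬-not) renaming (_≟_ to _≟ᵇ_)
open import Data.Fin using (Fin; zero; suc; toℕ)
open import Data.Fin.Properties using (_≟_; <⇒≢; any?)
open import Data.List using (List; []; _∷_; map; tabulate; filter; length; concatMap; _++_)
open import Data.List.Properties using (map-++)
open import Data.List.Membership.Propositional using (_∈_)
open import Data.List.Membership.Propositional.Properties using (∈-allFin)
open import Data.List.Relation.Unary.Any using (here; there)
open import Data.Product using (_×_; _,_)
open import Data.Sum using (inj₁; inj₂)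
open import Data.Unit using (tt)
open import Data.Empty using (⊥-elim)
open import Function using (_∘_; id)
open import Relation.Nullary using (yes; no; does)
open import Relation.Nullary.Decidable using (dec-true; dec-false)
open import Relation.Binary.PropositionalEquality
  using (_≢_; ≢-sym; refl; sym; trans; cong; cong₂; subst; module ≡-Reasoning)
open import Algebra.Properties.CommutativeMonoid.Sum +-0-commutativeMonoid
  using (sum-syntax; sum-cong-≗; sum-replicate-zero; ∑-distrib-+)

open ≡-Reasoning

indicator : Bool → ℕ
indicator b = if b then 1 else 0

count : ∀ {n} → (Fin n → Bool) → ℕ
count {n} p = ∑[ i < n ] indicator (p i)

count-cong : ∀ {n} {p q : Fin n → Bool} → (∀ i → p i ≡ q i) → count p ≡ count q
count-cong p≗q = sum-cong-≗ (cong indicator ∘ p≗q)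

count-all : ∀ n → count {n} (λ _ → true) ≡ n
count-all zero    = refl
count-all (suc n) = cong suc (count-all n)

count-none : ∀ {n} {p : Fin n → Bool} → (∀ i → p i ≡ false) → count p ≡ 0
count-none {n} none = trans (count-cong none) (sum-replicate-zero n)

count-complement : ∀ {n} (p : Fin n → Bool) → count p + count (not ∘ p) ≡ n
count-complement {n} p = begin
  count p + count (not ∘ p)
    ≡⟨ ∑-distrib-+ (indicator ∘ p) (indicator ∘ not ∘ p) ⟨
  ∑[ i < n ] (indicator (p i) + indicator (not (p i)))
    ≡⟨ sum-cong-≗ (indicator-partition ∘ p) ⟩
  count {n} (λ _ → true)
    ≡⟨ count-all n ⟩
  n ∎
  where
  indicator-partition : ∀ b → indicator b + indicator (not b) ≡ 1
  indicator-partition true  = refl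
  indicator-partition false = refl

count-≢ : ∀ {n} (i : Fin n) → count (λ j → not (does (i ≟ j))) ≡ n ∸ 1
count-≢ {suc n}       zero    = count-all n
count-≢ {suc (suc n)} (suc i) = cong suc (count-≢ i)

∑-by-class : ∀ {n} (g : Fin n → Bool) (h : Bool → ℕ) →
             ∑[ i < n ] h (g i) ≡ count g * h true + count (not ∘ g) * h false
∑-by-class {zero}  g h = refl
∑-by-class {suc n} g h with g zero | ∑-by-class (g ∘ suc) h
... | true  | ih = trans (cong (h true +_) ih) (sym (+-assoc (h true) (count (g ∘ suc) * h true) _))
... | false | ih = trans (cong (h false +_) ih) (exchange (h false) (count (g ∘ suc) * h true) _)
  where
  exchange : ∀ x y z → x + (y + z) ≡ y + (x + z)
  exchange = solve-∀

∑-upper : ∀ {n} → (Fin n → Fin n → ℕ) → ℕ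
∑-upper {n} w = ∑[ i < n ] ∑[ j < n ] (if toℕ i <ᵇ toℕ j then w i j else 0)

∑-upper-cong : ∀ {n} {v w : Fin n → Fin n → ℕ} →
               (∀ {i j} → toℕ i < toℕ j → v i j ≡ w i j) → ∑-upper v ≡ ∑-upper w
∑-upper-cong {v = v} {w} v≗w = sum-cong-≗ (λ i → sum-cong-≗ (entry i))
  where
  entry : ∀ i j → (if toℕ i <ᵇ toℕ j then v i j else 0) ≡ (if toℕ i <ᵇ toℕ j then w i j else 0)
  entry i j with toℕ i <ᵇ toℕ j in i<ᵇj
  ... | true  = v≗w (<ᵇ⇒< (toℕ i) (toℕ j) (subst T (sym i<ᵇj) tt))
  ... | false = refl

∑-upper-symmetric : ∀ {n} (w : Fin n → Fin n → ℕ) → (∀ i j → w i j ≡ w j i) →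
                    2 * ∑-upper w + ∑[ i < n ] w i i ≡ ∑[ i < n ] ∑[ j < n ] w i j
∑-upper-symmetric {zero}  w w-sym = refl
∑-upper-symmetric {suc n} w w-sym = begin
  2 * (row + ∑-upper w′) + (w zero zero + ∑[ i < n ] w′ i i)
    ≡⟨ rearrange row (∑-upper w′) (w zero zero) (∑[ i < n ] w′ i i) ⟩
  (w zero zero + row) + (row + (2 * ∑-upper w′ + ∑[ i < n ] w′ i i))
    ≡⟨ cong₂ (λ r t → (w zero zero + row) + (r + t)) row≡column
             (∑-upper-symmetric w′ (λ i j → w-sym (suc i) (suc j))) ⟩
  (w zero zero + row) + (∑[ i < n ] w (suc i) zero + ∑[ i < n ] ∑[ j < n ] w′ i j)
    ≡⟨ cong ((w zero zero + row) +_)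
            (∑-distrib-+ (λ i → w (suc i) zero) (λ i → ∑[ j < n ] w′ i j)) ⟨
  ∑[ i < suc n ] ∑[ j < suc n ] w i j
    ∎
  where
  w′ : Fin n → Fin n → ℕ
  w′ i j = w (suc i) (suc j)
  row : ℕ
  row = ∑[ j < n ] w zero (suc j)
  row≡column : row ≡ ∑[ i < n ] w (suc i) zero
  row≡column = sum-cong-≗ (λ j → w-sym zero (suc j))
  rearrange : ∀ r u d e → 2 * (r + u) + (d + e) ≡ (d + r) + (r + (2 * u + e))
  rearrange = solve-∀

classDiagonal : ℕ → ℕ → (Bool → Bool → ℕ) → ℕ
classDiagonal c c′ w = c * w true true + c′ * w false false

classTotal : ℕ → ℕ → (Bool → Bool → ℕ) → ℕ
classTotal c c′ w = c * (c * w true true + c′ * w true false) + c′ * (c * w false true + c′ * w false false)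

∑-upper-by-class : ∀ {n} (g : Fin n → Bool) (w : Bool → Bool → ℕ) → (∀ a b → w a b ≡ w b a) →
  let c = count g; c′ = count (not ∘ g) in
  2 * ∑-upper (λ i j → w (g i) (g j)) + classDiagonal c c′ w ≡ classTotal c c′ w
∑-upper-by-class {n} g w w-sym = begin
  2 * ∑-upper W + classDiagonal c c′ w
    ≡⟨ cong (2 * ∑-upper W +_) (∑-by-class g (λ a → w a a)) ⟨
  2 * ∑-upper W + ∑[ i < n ] W i i
    ≡⟨ ∑-upper-symmetric W (λ i j → w-sym (g i) (g j)) ⟩
  ∑[ i < n ] ∑[ j < n ] W i j
    ≡⟨ sum-cong-≗ (λ i → ∑-by-class g (w (g i))) ⟩
  ∑[ i < n ] (c * w (g i) true + c′ * w (g i) false)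
    ≡⟨ ∑-by-class g (λ a → c * w a true + c′ * w a false) ⟩
  classTotal c c′ w ∎
  where
  c c′ : ℕ
  c  = count g
  c′ = count (not ∘ g)
  W : Fin n → Fin n → ℕ
  W i j = w (g i) (g j)

module _ {A : Set} where

  length-filter-tabulate : ∀ {n} (f : Fin n → A) (p : A → Bool) →
                           length (filter (T? ∘ p) (tabulate f)) ≡ count (p ∘ f)
  length-filter-tabulate {zero}  f p = refl
  length-filter-tabulate {suc n} f p with p (f zero)
  ... | true  = cong suc (length-filter-tabulate (f ∘ suc) p)
  ... | false = length-filter-tabulate (f ∘ suc) p

  sum-map-tabulate : ∀ {n} (f : Fin n → A) (q : A → ℕ) → sum (map q (tabulate f)) ≡ ∑[ i < n ] q (f i)
  sum-map-tabulate {zero}  f q = refl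
  sum-map-tabulate {suc n} f q = cong (q (f zero) +_) (sum-map-tabulate (f ∘ suc) q)

  sum-map-concatMap : ∀ {B : Set} (w : B → ℕ) (F : A → List B) xs →
                      sum (map w (concatMap F xs)) ≡ sum (map (sum ∘ map w ∘ F) xs)
  sum-map-concatMap w F []       = refl
  sum-map-concatMap w F (x ∷ xs) = begin
    sum (map w (F x ++ concatMap F xs))
      ≡⟨ cong sum (map-++ w (F x) (concatMap F xs)) ⟩
    sum (map w (F x) ++ map w (concatMap F xs))
      ≡⟨ sum-++ (map w (F x)) (map w (concatMap F xs)) ⟩
    sum (map w (F x)) + sum (map w (concatMap F xs))
      ≡⟨ cong (sum (map w (F x)) +_) (sum-map-concatMap w F xs) ⟩
    sum (map w (F x)) + sum (map (sum ∘ map w ∘ F) xs) ∎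

-- Degrees and distances in a complete split graph with N + 1 vertices, s of them universal
-- (class true), as functions of the classes of the vertices involved.
splitDeg : ℕ → ℕ → Bool → ℕ
splitDeg N s true  = N
splitDeg N s false = s

splitDist : Bool → Bool → ℕ
splitDist false false = 2
splitDist _     _     = 1

splitDist-comm : ∀ a b → splitDist a b ≡ splitDist b a
splitDist-comm true  true  = refl
splitDist-comm true  false = refl
splitDist-comm false true  = refl
splitDist-comm false false = refl

splitWeight : ℕ → ℕ → Bool → Bool → ℕ
splitWeight N s a b = splitDeg N s a * splitDeg N s b * splitDist a b

splitWeight-comm : ∀ N s a b → splitWeight N s a b ≡ splitWeight N s b a
splitWeight-comm N s a b = cong₂ _*_ (*-comm (splitDeg N s a) (splitDeg N s b)) (splitDist-comm a b)

n*[n∸1]*x+n*x≡n*n*x : ∀ n x → n * (n ∸ 1) * x + n * x ≡ n * n * x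
n*[n∸1]*x+n*x≡n*n*x zero    x = refl
n*[n∸1]*x+n*x≡n*n*x (suc n) x = identity n x
  where
  identity : ∀ n x → suc n * n * x + suc n * x ≡ suc n * suc n * x
  identity = solve-∀

-- e stands for 2n − s − 2 and N for n − 1; relating them by e + 1 = N + s′ keeps the
-- identity free of truncated subtraction except in s ∸ 1.
gutman-identity : ∀ s s′ N e X → e + 1 ≡ N + s′ →
  2 * X + classDiagonal s s′ (splitWeight N s) ≡ classTotal s s′ (splitWeight N s) →
  2 * X ≡ s * (s ∸ 1) * N ^ 2 + 2 * (s * s * s′ * e)
gutman-identity s s′ N e X e+1≡N+s′ hyp =
  +-cancelʳ-≡ (classDiagonal s s′ (splitWeight N s)) (2 * X) _ (trans hyp (sym closed+diagonal))
  where
  regroup : ∀ a p b c d →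
    a * p * (b * (b * 1)) + 2 * (a * a * c * d) + (a * (b * b * 1) + c * (a * a * 2))
      ≡ (a * p * (b * (b * 1)) + a * (b * (b * 1))) + 2 * (a * a * c * (d + 1))
  regroup = solve-∀
  expand : ∀ a b c →
    a * a * (b * (b * 1)) + 2 * (a * a * c * (b + c))
      ≡ a * (a * (b * b * 1) + c * (b * a * 1)) + c * (a * (a * b * 1) + c * (a * a * 2))
  expand = solve-∀
  closed+diagonal : s * (s ∸ 1) * N ^ 2 + 2 * (s * s * s′ * e) + classDiagonal s s′ (splitWeight N s)
                    ≡ classTotal s s′ (splitWeight N s)
  closed+diagonal = begin
    s * (s ∸ 1) * N ^ 2 + 2 * (s * s * s′ * e) + classDiagonal s s′ (splitWeight N s)
      ≡⟨ regroup s (s ∸ 1) N s′ e ⟩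
    (s * (s ∸ 1) * N ^ 2 + s * N ^ 2) + 2 * (s * s * s′ * (e + 1))
      ≡⟨ cong₂ _+_ (n*[n∸1]*x+n*x≡n*n*x s (N ^ 2)) (cong (λ t → 2 * (s * s * s′ * t)) e+1≡N+s′) ⟩
    s * s * N ^ 2 + 2 * (s * s * s′ * (N + s′))
      ≡⟨ expand s N s′ ⟩
    classTotal s s′ (splitWeight N s)
      ∎

2*[2+m]∸s∸2≡s′+m : ∀ {m s s′} → s + s′ ≡ 2 + m → 2 * (2 + m) ∸ s ∸ 2 ≡ s′ + m
2*[2+m]∸s∸2≡s′+m {m} {s} {s′} s+s′≡n = begin
  2 * n ∸ s ∸ 2          ≡⟨ cong (λ t → t ∸ s ∸ 2) double ⟩
  s + (s′ + n) ∸ s ∸ 2   ≡⟨ cong (_∸ 2) (m+n∸m≡n s (s′ + n)) ⟩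
  s′ + n ∸ 2             ≡⟨ +-∸-assoc s′ (s≤s (s≤s z≤n)) ⟩
  s′ + m                 ∎
  where
  n : ℕ
  n = 2 + m
  double : 2 * n ≡ s + (s′ + n)
  double = begin
    n + (n + 0)   ≡⟨ cong (n +_) (+-identityʳ n) ⟩
    n + n         ≡⟨ cong (_+ n) (sym s+s′≡n) ⟩
    s + s′ + n    ≡⟨ +-assoc s s′ n ⟩
    s + (s′ + n)  ∎

gutman-closed-form : ∀ {m s s′ X} → s + s′ ≡ 2 + m → let n = 2 + m in
  2 * X + classDiagonal s s′ (splitWeight (n ∸ 1) s) ≡ classTotal s s′ (splitWeight (n ∸ 1) s) →
  2 * X ≡ s * (s ∸ 1) * (n ∸ 1) ^ 2 + 2 * (s * s * (n ∸ s) * (2 * n ∸ s ∸ 2))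
gutman-closed-form {m} {s} {s′} {X} s+s′≡n hyp = begin
  2 * X
    ≡⟨ gutman-identity s s′ (suc m) e X e+1≡N+s′ hyp ⟩
  s * (s ∸ 1) * suc m ^ 2 + 2 * (s * s * s′ * e)
    ≡⟨ cong (λ d → s * (s ∸ 1) * suc m ^ 2 + 2 * (s * s * d * e)) n∸s≡s′ ⟨
  s * (s ∸ 1) * suc m ^ 2 + 2 * (s * s * (2 + m ∸ s) * e) ∎
  where
  e : ℕ
  e = 2 * (2 + m) ∸ s ∸ 2
  e+1≡N+s′ : e + 1 ≡ suc m + s′
  e+1≡N+s′ = trans (cong (_+ 1) (2*[2+m]∸s∸2≡s′+m s+s′≡n))
                   (trans (+-comm (s′ + m) 1) (cong suc (+-comm s′ m)))
  n∸s≡s′ : 2 + m ∸ s ≡ s′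
  n∸s≡s′ = trans (cong (_∸ s) (sym s+s′≡n)) (m+n∸m≡n s s′)

module GeneratorGraphProperties (G : Group 0ℓ 0ℓ) (n : ℕ) (ord : GroupDefs.HasOrder G n)
  (_≈?_ : ∀ x y → Dec (Group._≈_ G x y))
  (gen? : ∀ x → Dec (GroupDefs.IsGenerator G x)) where

  open Group G using () renaming (refl to ≈-refl)
  open GroupDefs.HasOrder ord
  open GeneratorGraph G n ord _≈?_ gen?

  same-refl : ∀ i → same i i ≡ true
  same-refl i = dec-true (enum i ≈? enum i) ≈-refl

  same-≢ : ∀ {i j} → i ≢ j → same i j ≡ false
  same-≢ {i} {j} i≢j = dec-false (enum i ≈? enum j) (i≢j ∘ injective i j)

  adj-irrefl : ∀ i → adj i i ≡ false
  adj-irrefl i rewrite same-refl i = refl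

  adj-≢ : ∀ {i j} → i ≢ j → adj i j ≡ isGen i ∨ isGen j
  adj-≢ i≢j rewrite same-≢ i≢j = refl

  adj-by-class : ∀ {i j a b} → i ≢ j → isGen i ≡ a → isGen j ≡ b → adj i j ≡ a ∨ b
  adj-by-class i≢j gi gj = trans (adj-≢ i≢j) (cong₂ _∨_ gi gj)

  isGen-≢ : ∀ {i j} → isGen i ≡ false → isGen j ≡ true → i ≢ j
  isGen-≢ gi gj refl with () ← trans (sym gi) gj

  numGen≡count : numGen ≡ count isGen
  numGen≡count = length-filter-tabulate id isGen

  numNonGen : ℕ
  numNonGen = count (not ∘ isGen)

  numGen+numNonGen≡n : numGen + numNonGen ≡ n
  numGen+numNonGen≡n = trans (cong (_+ numNonGen) numGen≡count) (count-complement isGen)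

  deg-generator : ∀ {i} → isGen i ≡ true → deg i ≡ n ∸ 1
  deg-generator {i} gi = trans (length-filter-tabulate id (adj i)) (trans (count-cong adj≡≢) (count-≢ i))
    where
    adj≡≢ : ∀ j → adj i j ≡ not (does (i ≟ j))
    adj≡≢ j with i ≟ j
    ... | yes refl = adj-irrefl i
    ... | no i≢j   = adj-by-class i≢j gi refl

  deg-nongenerator : ∀ {i} → isGen i ≡ false → deg i ≡ numGen
  deg-nongenerator {i} gi =
    trans (length-filter-tabulate id (adj i)) (trans (count-cong adj≡isGen) (sym numGen≡count))
    where
    adj≡isGen : ∀ j → adj i j ≡ isGen j
    adj≡isGen j with i ≟ j
    ... | yes refl = trans (adj-irrefl i) (sym gi)
    ... | no i≢j   = adj-by-class i≢j gi refl

  deg-by-class : ∀ i → deg i ≡ splitDeg (n ∸ 1) numGen (isGen i)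
  deg-by-class i = by-class (isGen i) refl
    where
    by-class : ∀ b → isGen i ≡ b → deg i ≡ splitDeg (n ∸ 1) numGen b
    by-class true  = deg-generator
    by-class false = deg-nongenerator

  anyL-true : ∀ {xs l} (p : V → Bool) → l ∈ xs → p l ≡ true → anyL xs p ≡ true
  anyL-true p (here refl) pl rewrite pl = refl
  anyL-true {x ∷ _} p (there l∈xs) pl rewrite anyL-true p l∈xs pl = ∨-zeroʳ (p x)

  anyL-false : ∀ xs (p : V → Bool) → (∀ l → p l ≡ false) → anyL xs p ≡ false
  anyL-false []       p none = refl
  anyL-false (x ∷ xs) p none rewrite none x = anyL-false xs p none

  walk-1 : ∀ i j → walk 1 i j ≡ adj i j
  walk-1 i j = by-adjacency (adj i j) refl
    where
    by-adjacency : ∀ b → adj i j ≡ b → walk 1 i j ≡ b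
    by-adjacency true  aij =
      anyL-true (λ l → adj i l ∧ same l j) (∈-allFin j) (cong₂ _∧_ aij (same-refl j))
    by-adjacency false aij = anyL-false vs (λ l → adj i l ∧ same l j) last-step
      where
      last-step : ∀ l → adj i l ∧ same l j ≡ false
      last-step l with l ≟ j
      ... | yes refl = cong (_∧ same l l) aij
      ... | no l≢j   = trans (cong (adj i l ∧_) (same-≢ l≢j)) (∧-zeroʳ (adj i l))

  walk-2 : ∀ {i j} l → adj i l ≡ true → adj l j ≡ true → walk 2 i j ≡ true
  walk-2 {i} {j} l ail alj =
    anyL-true (λ k → adj i k ∧ walk 1 k j) (∈-allFin l) (cong₂ _∧_ ail (trans (walk-1 l j) alj))

  distFrom-least : ∀ {i j k} a b → a ≤ k → k ≤ a + b →
                   (∀ {k′} → k′ < k → walk k′ i j ≡ false) → walk k i j ≡ true →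
                   distFrom a b i j ≡ k
  distFrom-least {k = k} a zero a≤k k≤a+0 shorter wk with m≤n⇒m<n∨m≡n a≤k
  ... | inj₂ refl rewrite wk = refl
  ... | inj₁ a<k = ⊥-elim (<⇒≱ a<k (subst (k ≤_) (+-identityʳ a) k≤a+0))
  distFrom-least {k = k} a (suc b) a≤k k≤a+b shorter wk with m≤n⇒m<n∨m≡n a≤k
  ... | inj₂ refl rewrite wk = refl
  ... | inj₁ a<k rewrite shorter a<k =
    distFrom-least (suc a) b a<k (subst (k ≤_) (+-suc a b) k≤a+b) shorter wk

  dist-least : ∀ {i j k} → k ≤ n → (∀ {k′} → k′ < k → walk k′ i j ≡ false) →
               walk k i j ≡ true → dist i j ≡ k
  dist-least k≤n = distFrom-least 0 n z≤n k≤n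

  dist-adjacent : ∀ {i j} → 1 ≤ n → i ≢ j → adj i j ≡ true → dist i j ≡ 1
  dist-adjacent {i} {j} 1≤n i≢j aij =
    dist-least 1≤n (λ { (s≤s z≤n) → same-≢ i≢j }) (trans (walk-1 i j) aij)

  dist-two : ∀ {i j} l → 2 ≤ n → i ≢ j → adj i j ≡ false →
             adj i l ≡ true → adj l j ≡ true → dist i j ≡ 2
  dist-two {i} {j} l 2≤n i≢j aij ail alj = dist-least 2≤n shorter (walk-2 l ail alj)
    where
    shorter : ∀ {k} → k < 2 → walk k i j ≡ false
    shorter (s≤s z≤n)       = same-≢ i≢j
    shorter (s≤s (s≤s z≤n)) = trans (walk-1 i j) aij

  dist-by-class : ∀ {i j l} → 2 ≤ n → i ≢ j → isGen l ≡ true →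
                  dist i j ≡ splitDist (isGen i) (isGen j)
  dist-by-class {i} {j} {l} 2≤n i≢j gl = by-class (isGen i) (isGen j) refl refl
    where
    by-class : ∀ a b → isGen i ≡ a → isGen j ≡ b → dist i j ≡ splitDist a b
    by-class true  b     gi gj = dist-adjacent (<⇒≤ 2≤n) i≢j (adj-by-class i≢j gi gj)
    by-class false true  gi gj = dist-adjacent (<⇒≤ 2≤n) i≢j (adj-by-class i≢j gi gj)
    by-class false false gi gj = dist-two l 2≤n i≢j (adj-by-class i≢j gi gj)
      (adj-by-class (isGen-≢ gi gl) gi gl) (adj-by-class (≢-sym (isGen-≢ gj gl)) gl gj)

  weight : Bool → Bool → ℕ
  weight = splitWeight (n ∸ 1) numGen

  weight-by-class : ∀ {i j} → 2 ≤ n → i ≢ j → deg i * deg j * dist i j ≡ weight (isGen i) (isGen j)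
  weight-by-class {i} {j} 2≤n i≢j with any? (λ l → isGen l ≟ᵇ true)
  ... | yes (l , gl) = cong₂ _*_ (cong₂ _*_ (deg-by-class i) (deg-by-class j)) (dist-by-class 2≤n i≢j gl)
  ... | no no-gen    = trans (cong (λ d → d * deg j * dist i j) deg-i≡0) (sym weight≡0)
    where
    nonGen : ∀ l → isGen l ≡ false
    nonGen l = ¬-not (λ gl → no-gen (l , gl))
    numGen≡0 : numGen ≡ 0
    numGen≡0 = trans numGen≡count (count-none nonGen)
    deg-i≡0 : deg i ≡ 0
    deg-i≡0 = trans (deg-nongenerator (nonGen i)) numGen≡0
    weight≡0 : weight (isGen i) (isGen j) ≡ 0
    weight≡0 = trans (cong₂ weight (nonGen i) (nonGen j)) (cong (λ s → s * s * 2) numGen≡0)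

  sum-map-pairs : ∀ (w : V × V → ℕ) → sum (map w pairs) ≡ ∑-upper (λ i j → w (i , j))
  sum-map-pairs w = begin
    sum (map w (concatMap row vs))                  ≡⟨ sum-map-concatMap w row vs ⟩
    sum (map (sum ∘ map w ∘ row) vs)                ≡⟨ sum-map-tabulate id (sum ∘ map w ∘ row) ⟩
    ∑[ i < n ] sum (map w (concatMap (entry i) vs)) ≡⟨ sum-cong-≗ row-sum ⟩
    ∑-upper (λ i j → w (i , j))                     ∎
    where
    entry : V → V → List (V × V)
    entry i j = if toℕ i <ᵇ toℕ j then (i , j) ∷ [] else []
    row : V → List (V × V)
    row i = concatMap (entry i) vs
    entry-sum : ∀ i j b → sum (map w (if b then (i , j) ∷ [] else [])) ≡ (if b then w (i , j) else 0)
    entry-sum i j true  = +-identityʳ (w (i , j))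
    entry-sum i j false = refl
    row-sum : ∀ i → sum (map w (row i)) ≡ ∑[ j < n ] (if toℕ i <ᵇ toℕ j then w (i , j) else 0)
    row-sum i = begin
      sum (map w (concatMap (entry i) vs))
        ≡⟨ sum-map-concatMap w (entry i) vs ⟩
      sum (map (sum ∘ map w ∘ entry i) vs)
        ≡⟨ sum-map-tabulate id (sum ∘ map w ∘ entry i) ⟩
      ∑[ j < n ] sum (map w (entry i j))
        ≡⟨ sum-cong-≗ (λ j → entry-sum i j (toℕ i <ᵇ toℕ j)) ⟩
      ∑[ j < n ] (if toℕ i <ᵇ toℕ j then w (i , j) else 0) ∎

  gutman-by-class : 2 ≤ n →
    2 * gutman + classDiagonal numGen numNonGen weight ≡ classTotal numGen numNonGen weight
  gutman-by-class 2≤n =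
    subst (λ c → 2 * gutman + classDiagonal c numNonGen weight ≡ classTotal c numNonGen weight)
      (sym numGen≡count)
      (trans (cong (λ u → 2 * u + classDiagonal (count isGen) numNonGen weight) gutman≡∑-upper)
             (∑-upper-by-class isGen weight (splitWeight-comm _ _)))
    where
    gutman≡∑-upper : gutman ≡ ∑-upper (λ i j → weight (isGen i) (isGen j))
    gutman≡∑-upper = trans (sum-map-pairs _) (∑-upper-cong (λ i<j → weight-by-class 2≤n (<⇒≢ i<j)))

theorem4p3 : (G : Group 0ℓ 0ℓ) (n : ℕ) (ord : GroupDefs.HasOrder G n)
    → 2 ≤ n
    → GroupDefs.IsCyclic G
    → (_≈?_ : ∀ x y → Dec (Group._≈_ G x y))
    → (gen? : ∀ x → Dec (GroupDefs.IsGenerator G x))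
    → let open GeneratorGraph G n ord _≈?_ gen?
          s = numGen
      in 2 * gutman ≡ s * (s ∸ 1) * (n ∸ 1) ^ 2 + 2 * (s * s * (n ∸ s) * (2 * n ∸ s ∸ 2))
theorem4p3 G n ord 2≤n@(s≤s (s≤s _)) _ _≈?_ gen? =
  gutman-closed-form {s = numGen} {numNonGen} {gutman} numGen+numNonGen≡n (gutman-by-class 2≤n)
  where
  open GeneratorGraph G n ord _≈?_ gen?
  open GeneratorGraphProperties G n ord _≈?_ gen?
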